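{- (1) The maps $\oplus,\ominus:\wp(\mathbb{T})\to\wp(\mathbb{T})$ preserve arbitrary unions and arbitrary intersections, and they are mutually inverse bijections: $\oplus^{ -1}=\ominus$ and $\ominus^{ -1}=\oplus$. Let $\rho$ be an upper closure operator on $\langle\wp(\mathbb{T}),\supseteq\rangle$. Then (2) $\rho$ is complete for $\oplus$ if and only if for all $n\in\mathbb{N}$ and $X\subseteq\mathbb{T}$, $\ominus^n(\rho(X))=\rho(\ominus^n(\rho(X)))$; and (3) $\rho$ is complete for $\ominus$ if and only if for all $n\in\mathbb{N}$ and $X\subseteq\mathbb{T}$, $\oplus^n(\rho(X))=\rho(\oplus^n(\rho(X)))$.
   Context: $\mathbb{T}$ is the set of traces $\langle i,\sigma\rangle$, $i\in\mathbb{Z}$, $\sigma:\mathbb{Z}\to\mathbb{S}$ for a set of states $\mathbb{S}$. $\oplus(X)=\{\langle i,\sigma\rangle\mid\langle i+1,\sigma\rangle\in X\}$ and $\ominus(X)=\{\langle i,\sigma\rangle\mid\langle i-1,\sigma\rangle\in X\}$. An upper closure operator on $\langle\wp(\mathbb{T}),\supseteq\rangle$ is a map $\rho$ monotone w.r.t. $\subseteq$, idempotent, with $\rho(X)\subseteq X$. $\rho$ is complete for $f$ if $\rho\circ f=\rho\circ f\circ\rho$. -}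

module Defs where

open import Level using (0ℓ)
open import Data.Nat.Base using (ℕ; zero; suc)
open import Data.Integer.Base using (ℤ; _+_; _-_; 1ℤ)
open import Data.Product.Base using (_×_; _,_)
open import Relation.Unary using (Pred; _⊆_; _≐_)

Trace : Set → Set
Trace S = ℤ × (ℤ → S)

PT : Set → Set₁
PT S = Pred (Trace S) 0ℓ

⊕ : {S : Set} → PT S → PT S
⊕ X (i , σ) = X (i + 1ℤ , σ)

⊖ : {S : Set} → PT S → PT S
⊖ X (i , σ) = X (i - 1ℤ , σ)

iter : {A : Set₁} → (A → A) → ℕ → A → A
iter f zero x = x
iter f (suc n) x = f (iter f n x)

record IsUpperClosure {S : Set} (ρ : PT S → PT S) : Set₁ where
  field
    monotone   : ∀ {X Y : PT S} → X ⊆ Y → ρ X ⊆ ρ Y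
    idempotent : ∀ (X : PT S) → ρ (ρ X) ≐ ρ X
    reductive  : ∀ (X : PT S) → ρ X ⊆ X

IsComplete : {S : Set} → (ρ : PT S → PT S) → (PT S → PT S) → Set₁
IsComplete ρ f = ∀ X → ρ (f X) ≐ ρ (f (ρ X))

{-# OPTIONS --safe #-}
-- ⊕ and ⊖ are precomposition with the shifts i ↦ i ± 1, so they commute with
-- ⋃ and ⋂ and are mutually inverse order isomorphisms of ℘(𝕋). For such an
-- isomorphism f with inverse g, ρ is complete for f exactly when g maps
-- ρ-closed sets to ρ-closed sets: ρ (f X) ⊆ f (ρ X) because g (ρ (f X)) is then
-- a closed subset of X, and ρ X is the largest one. Preservation by g is
-- preservation by every gⁿ.
module Submission where

open import Defs
open import Data.Nat.Base using (ℕ; zero; suc)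
open import Data.Integer.Base using (ℤ; 1ℤ)
open import Data.Integer.Properties using (+-0-abelianGroup)
open import Data.Product.Base using (_×_; _,_; proj₁; proj₂)
open import Function.Base using (_∘_)
open import Function.Bundles using (_⇔_; mk⇔)
open import Relation.Binary.PropositionalEquality using (_≡_; subst; sym)
open import Relation.Unary using (_⊆_; _≐_; ⋃; ⋂)
open import Relation.Unary.Properties using (≐-refl)
open import Algebra.Properties.AbelianGroup +-0-abelianGroup using (//-rightDividesˡ; //-rightDividesʳ)

reindex-≐ : {S : Set} {h : ℤ → ℤ} → (∀ i → h i ≡ i) →
            (X : PT S) → (λ t → X (h (proj₁ t) , proj₂ t)) ≐ X
reindex-≐ h≗id X =
    (λ {(i , σ)} → subst (λ j → X (j , σ)) (h≗id i))
  , (λ {(i , σ)} → subst (λ j → X (j , σ)) (sym (h≗id i)))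

-- In the additive group of ℤ, i - j is i // j.
⊕∘⊖≐id : {S : Set} (X : PT S) → ⊕ (⊖ X) ≐ X
⊕∘⊖≐id = reindex-≐ (//-rightDividesʳ 1ℤ)

⊖∘⊕≐id : {S : Set} (X : PT S) → ⊖ (⊕ X) ≐ X
⊖∘⊕≐id = reindex-≐ (//-rightDividesˡ 1ℤ)

⊕-mono : {S : Set} {X Y : PT S} → X ⊆ Y → ⊕ X ⊆ ⊕ Y
⊕-mono X⊆Y = X⊆Y

⊖-mono : {S : Set} {X Y : PT S} → X ⊆ Y → ⊖ X ⊆ ⊖ Y
⊖-mono X⊆Y = X⊆Y

module _ {S : Set} {ρ : PT S → PT S} (ρ-upper : IsUpperClosure ρ) where
  open IsUpperClosure ρ-upper

  Closed : PT S → Set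
  Closed Y = Y ≐ ρ Y

  ρ-closed : ∀ X → Closed (ρ X)
  ρ-closed X = proj₂ (idempotent X) , proj₁ (idempotent X)

  ⊆ρ⇒closed : ∀ {Y} → Y ⊆ ρ Y → Closed Y
  ⊆ρ⇒closed Y⊆ρY = Y⊆ρY , reductive _

  closed-⊆⇒⊆ρ : ∀ {Z X} → Closed Z → Z ⊆ X → Z ⊆ ρ X
  closed-⊆⇒⊆ρ (Z⊆ρZ , _) Z⊆X = monotone Z⊆X ∘ Z⊆ρZ

  module OrderIso (f g : PT S → PT S)
    (f-mono : ∀ {X Y} → X ⊆ Y → f X ⊆ f Y)
    (g-mono : ∀ {X Y} → X ⊆ Y → g X ⊆ g Y)
    (f∘g≐id : ∀ X → f (g X) ≐ X)
    (g∘f≐id : ∀ X → g (f X) ≐ X) where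

    ⊆f⇒g⊆ : ∀ {X Y} → X ⊆ f Y → g X ⊆ Y
    ⊆f⇒g⊆ {Y = Y} X⊆fY = proj₁ (g∘f≐id Y) ∘ g-mono X⊆fY

    g⊆⇒⊆f : ∀ {X Y} → g X ⊆ Y → X ⊆ f Y
    g⊆⇒⊆f {X} gX⊆Y = f-mono gX⊆Y ∘ proj₂ (f∘g≐id X)

    complete⇒g-closed : IsComplete ρ f → ∀ Y → Closed (g (ρ Y))
    complete⇒g-closed complete Y = ⊆ρ⇒closed (⊆f⇒g⊆ ρY⊆fρZ)
      where
        Z : PT S
        Z = g (ρ Y)
        ρY⊆fρZ : ρ Y ⊆ f (ρ Z)
        ρY⊆fρZ = reductive _ ∘ proj₁ (complete Z)
               ∘ closed-⊆⇒⊆ρ (ρ-closed Y) (proj₂ (f∘g≐id (ρ Y)))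

    g-closed⇒complete : (∀ Y → Closed (g (ρ Y))) → IsComplete ρ f
    g-closed⇒complete g-closed X = closed-⊆⇒⊆ρ (ρ-closed (f X)) ρfX⊆fρX
                                 , monotone (f-mono (reductive X))
      where
        ρfX⊆fρX : ρ (f X) ⊆ f (ρ X)
        ρfX⊆fρX = g⊆⇒⊆f (closed-⊆⇒⊆ρ (g-closed (f X)) (⊆f⇒g⊆ (reductive (f X))))

    g-preserves-closed : (∀ Y → Closed (g (ρ Y))) → ∀ {Y} → Closed Y → Closed (g Y)
    g-preserves-closed g-closed {Y} (Y⊆ρY , _) =
      ⊆ρ⇒closed (closed-⊆⇒⊆ρ (g-closed Y) (g-mono (reductive Y)) ∘ g-mono Y⊆ρY)

    iter-g-closed : (∀ Y → Closed (g (ρ Y))) → ∀ n X → Closed (iter g n (ρ X))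
    iter-g-closed g-closed zero    X = ρ-closed X
    iter-g-closed g-closed (suc n) X = g-preserves-closed g-closed (iter-g-closed g-closed n X)

    complete⇔iter-g-closed : IsComplete ρ f ⇔ (∀ n X → Closed (iter g n (ρ X)))
    complete⇔iter-g-closed = mk⇔ (iter-g-closed ∘ complete⇒g-closed)
                                 (λ iter-closed → g-closed⇒complete (iter-closed 1))

lemma2 : (S : Set) →
    -- (1) ⊕ and ⊖ preserve arbitrary unions and intersections
    ((I : Set) (F : I → PT S) → ⊕ (⋃ I F) ≐ ⋃ I (λ k → ⊕ (F k))) ×
    ((I : Set) (F : I → PT S) → ⊕ (⋂ I F) ≐ ⋂ I (λ k → ⊕ (F k))) ×
    ((I : Set) (F : I → PT S) → ⊖ (⋃ I F) ≐ ⋃ I (λ k → ⊖ (F k))) ×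
    ((I : Set) (F : I → PT S) → ⊖ (⋂ I F) ≐ ⋂ I (λ k → ⊖ (F k))) ×
    -- (1) ⊕ and ⊖ are mutually inverse bijections
    ((X : PT S) → ⊕ (⊖ X) ≐ X) ×
    ((X : PT S) → ⊖ (⊕ X) ≐ X) ×
    -- (2), (3) for every upper closure operator ρ
    ((ρ : PT S → PT S) → IsUpperClosure ρ →
      (IsComplete ρ ⊕ ⇔ ((n : ℕ) (X : PT S) → iter ⊖ n (ρ X) ≐ ρ (iter ⊖ n (ρ X)))) ×
      (IsComplete ρ ⊖ ⇔ ((n : ℕ) (X : PT S) → iter ⊕ n (ρ X) ≐ ρ (iter ⊕ n (ρ X)))))
lemma2 S =
    (λ _ _ → ≐-refl) , (λ _ _ → ≐-refl) , (λ _ _ → ≐-refl) , (λ _ _ → ≐-refl)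
  , ⊕∘⊖≐id , ⊖∘⊕≐id
  , λ ρ ρ-upper →
      OrderIso.complete⇔iter-g-closed ρ-upper ⊕ ⊖ ⊕-mono ⊖-mono ⊕∘⊖≐id ⊖∘⊕≐id
    , OrderIso.complete⇔iter-g-closed ρ-upper ⊖ ⊕ ⊖-mono ⊕-mono ⊖∘⊕≐id ⊕∘⊖≐id
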